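{- Let $D$ and $D'$ be finite simple digraphs such that $D'$ is a butterfly minor of $D$. Then $\mathrm{NCW}_\emptyset(D') \le \mathrm{NCW}_\emptyset(D)$.
   Context: All digraphs are finite and simple. An edge $(u,v)$ of a digraph is butterfly contractible if it is the only edge with tail $u$ or the only edge with head $v$. A butterfly minor of $D$ is a digraph obtained from a subgraph of $D$ by contracting butterfly contractible edges. An abstract digraph decomposition of a digraph $D$ is a triple $(T,\beta,\gamma)$ where $T$ is a rooted directed tree (edges directed away from the root), $\beta:V(T)\to 2^{V(D)}$, $\gamma:E(T)\to 2^{V(D)}$, and $\bigcup_{t\in V(T)}\beta(t)=V(D)$. For $t\in V(T)$ let $\Gamma(t)=\beta(t)\cup\bigcup_{e \text{ incident with } t}\gamma(e)$, let $T_t$ be the subtree of $T$ induced by the nodes reachable from $t$ by a directed path in $T$, and for a subtree $S$ let $\beta(S)=\bigcup_{t\in V(S)}\beta(t)$. The width is $\max\{|\Gamma(t)|-1 : t\in V(T)\}$. An $\mathrm{NCW}_\emptyset$-directed tree decomposition of $D$ is an abstract digraph decomposition such that (1) $\{\beta(t):t\in V(T)\}$ is a partition of $V(D)$ into possibly empty sets with $\beta(r)\neq\emptyset$ for the root $r$ of $T$, and (2) for every edge $e=(s,t)\in E(T)$ there is no closed walk in $D-\gamma(e)$ containing a vertex of $\beta(T_t)$ and a vertex of $V(D)-\beta(T_t)$. $\mathrm{NCW}_\emptyset(D)$ is the minimum width of an $\mathrm{NCW}_\emptyset$-directed tree decomposition of $D$. -}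

module Defs where

open import Data.Nat using (ℕ; zero; suc; _+_; _∸_; _⊔_; _≤_)
open import Data.Bool using (Bool; true; false; if_then_else_)
open import Data.Fin using (Fin)
open import Data.Fin.Subset using (Subset; ⊥; _∪_; ∣_∣; _∈_; _∉_)
open import Data.Vec using (lookup)
open import Data.List using (List; []; _∷_; _++_; [_])
open import Data.List.Membership.Propositional using () renaming (_∈_ to _∈ˡ_)
open import Data.List.Relation.Unary.All using (All)
open import Data.Product using (Σ; _×_; _,_; ∃)
open import Data.Sum using (_⊎_)
open import Data.Unit using (⊤)
open import Data.Empty renaming (⊥ to Empty)
open import Relation.Nullary using (¬_)
open import Relation.Binary.PropositionalEquality using (_≡_; _≢_)

-- Finite simple digraphs: vertex set Fin size, adjacency as a Bool
-- relation (so at most one edge per ordered pair), no loops.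

record Digraph : Set where
  field
    size     : ℕ
    adj      : Fin size → Fin size → Bool
    loopless : ∀ v → adj v v ≡ false
open Digraph public

Edge : (D : Digraph) → Fin (size D) → Fin (size D) → Set
Edge D u v = adj D u v ≡ true

SubgraphOf : Digraph → Digraph → Set
SubgraphOf S D =
  Σ (Fin (size S) → Fin (size D)) λ f →
    (∀ x y → f x ≡ f y → x ≡ y) ×
    (∀ u v → Edge S u v → Edge D (f u) (f v))

ButterflyContractible : (D : Digraph) → Fin (size D) → Fin (size D) → Set
ButterflyContractible D u v =
  Edge D u v ×
  ((∀ w → Edge D u w → w ≡ v) ⊎ (∀ w → Edge D w v → w ≡ u))

-- D' is (isomorphic to) the digraph obtained from D by contracting the
-- edge (u,v): identify u and v (only), delete arising loops and
-- parallel edges (the simple-digraph quotient).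
ContractionOf : (D' D : Digraph) → Fin (size D) → Fin (size D) → Set
ContractionOf D' D u v =
  Σ (Fin (size D) → Fin (size D')) λ φ →
    (∀ a → ∃ λ x → φ x ≡ a) ×
    (φ u ≡ φ v) ×
    (∀ x y → φ x ≡ φ y →
       x ≡ y ⊎ ((x ≡ u ⊎ x ≡ v) × (y ≡ u ⊎ y ≡ v))) ×
    (∀ a b → (Edge D' a b →
                 a ≢ b × Σ (Fin (size D)) λ x → Σ (Fin (size D)) λ y →
                           φ x ≡ a × φ y ≡ b × Edge D x y)
           × (a ≢ b × Σ (Fin (size D)) λ x → Σ (Fin (size D)) λ y →
                           φ x ≡ a × φ y ≡ b × Edge D x y
              → Edge D' a b))

data Contracts : Digraph → Digraph → Set where
  done : ∀ {D} → Contracts D D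
  step : ∀ {D D₁ D₂} (u v : Fin (size D)) →
         ButterflyContractible D u v → ContractionOf D₁ D u v →
         Contracts D₁ D₂ → Contracts D D₂

ButterflyMinor : Digraph → Digraph → Set
ButterflyMinor D' D = Σ Digraph λ S → SubgraphOf S D × Contracts S D'

-- Rooted directed trees with bags: each node carries β(t); each edge
-- to a child carries γ(e).  Edges are directed away from the root.

data DTree (n : ℕ) : Set where
  node : Subset n → List (Subset n × DTree n) → DTree n

module _ {n : ℕ} where
  mutual
    βsub : DTree n → Subset n
    βsub (node b cs) = b ∪ βsubs cs

    βsubs : List (Subset n × DTree n) → Subset n
    βsubs [] = ⊥
    βsubs ((g , t) ∷ cs) = βsub t ∪ βsubs cs

  mutual
    occ : Fin n → DTree n → ℕ
    occ v (node b cs) = (if lookup b v then 1 else 0) + occs v cs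

    occs : Fin n → List (Subset n × DTree n) → ℕ
    occs v [] = 0
    occs v ((g , t) ∷ cs) = occ v t + occs v cs

  γchildren : List (Subset n × DTree n) → Subset n
  γchildren [] = ⊥
  γchildren ((g , t) ∷ cs) = g ∪ γchildren cs

  mutual
    -- max over nodes of |Γ(t)| - 1, given γ of the edge into the subtree root
    widthFrom : Subset n → DTree n → ℕ
    widthFrom g (node b cs) = (∣ b ∪ (g ∪ γchildren cs) ∣ ∸ 1) ⊔ widthsFrom cs

    widthsFrom : List (Subset n × DTree n) → ℕ
    widthsFrom [] = 0
    widthsFrom ((g , t) ∷ cs) = widthFrom g t ⊔ widthsFrom cs

  -- the root has no incoming edge
  width : DTree n → ℕ
  width t = widthFrom ⊥ t

  rootBag : DTree n → Subset n
  rootBag (node b cs) = b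

module _ (D : Digraph) where
  IsWalk : List (Fin (size D)) → Set
  IsWalk [] = ⊤
  IsWalk (x ∷ []) = ⊤
  IsWalk (x ∷ y ∷ ys) = Edge D x y × IsWalk (y ∷ ys)

  IsClosedWalkIn-Minus : Subset (size D) → Fin (size D) → List (Fin (size D)) → Set
  IsClosedWalkIn-Minus X x xs =
    IsWalk ((x ∷ xs) ++ [ x ]) × All (λ v → v ∉ X) (x ∷ xs)

  NoCrossingClosedWalk : Subset (size D) → Subset (size D) → Set
  NoCrossingClosedWalk X S =
    ∀ x xs → IsClosedWalkIn-Minus X x xs →
    ∀ p q → p ∈ˡ (x ∷ xs) → q ∈ˡ (x ∷ xs) → p ∈ S → q ∉ S → Empty

  mutual
    EdgesOK : DTree (size D) → Set
    EdgesOK (node b cs) = EdgesOKs cs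

    EdgesOKs : List (Subset (size D) × DTree (size D)) → Set
    EdgesOKs [] = ⊤
    EdgesOKs ((g , t) ∷ cs) =
      NoCrossingClosedWalk g (βsub t) × EdgesOK t × EdgesOKs cs

  IsNCWDecomposition : DTree (size D) → Set
  IsNCWDecomposition T =
    (∀ v → occ v T ≡ 1) ×
    (∃ λ v → v ∈ rootBag T) ×
    EdgesOK T

  IsNCW : ℕ → Set
  IsNCW w =
    (Σ (DTree (size D)) λ T → IsNCWDecomposition T × width T ≡ w) ×
    (∀ T → IsNCWDecomposition T → w ≤ width T)

-- In each of the steps producing a butterfly minor (passing to a subgraph, contracting one butterfly
-- contractible edge) every vertex a of the smaller digraph D′ is modelled by at most two vertices
-- rep₁ a, rep₂ a of the larger digraph D, and every edge a → c of D′ lifts to a walk of D from rep₁ a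
-- to rep₁ c through these branch sets. For a contraction this is where butterfly contractibility
-- enters: since the contracted edge is the only edge leaving its tail (or entering its head), each
-- edge of the contraction lifts to an edge of D, possibly extended by the contracted edge.
--
-- A decomposition of D is pulled back by putting a into the bag of rep₁ a and into γ(e) whenever its
-- branch set meets γ(e). The bags stay a partition, a crossing closed walk in D′ - γ′(e) would lift to
-- one in D - γ(e), and choosing for each a ∈ Γ′(t) a representative in Γ(t) injects Γ′(t) into Γ(t),
-- so the width does not grow. Only the root bag may become empty; rotating the tree one edge at a time
-- towards a node with a nonempty bag repairs this without changing any Γ(t), since the condition on a
-- tree edge is invariant under replacing β(T_t) by its complement.

{-# OPTIONS --safe #-}
module Submission where

open import Defs
open import Data.Nat using (ℕ; zero; suc; _+_; _∸_; _⊔_; _≤_; _<_; z≤n; s≤s)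
open import Data.Nat.Properties
  using (≤-refl; ≤-trans; ≤-reflexive; ≤-<-trans; ⊔-mono-≤; ∸-monoˡ-≤; m≤m+n; m≤n+m; +-mono-≤;
         ≮⇒≥; n≤0⇒n≡0; +-assoc; ⊔-assoc; +-0-commutativeMonoid; ⊔-0-commutativeMonoid)
open import Data.Bool using (true; false; _∨_; if_then_else_)
import Algebra.Solver.CommutativeMonoid as CMSolver
import Algebra.Solver.IdempotentCommutativeMonoid as ICMSolver
open import Data.Fin using (Fin; zero; suc)
open import Data.Fin.Properties using (_≟_; suc-injective; 0≢1+n)
open import Data.Fin.Subset using (Subset; ⊥; _∪_; ∣_∣; _∈_; _∉_; _⊆_; _-_; inside; outside)
open import Data.Fin.Subset.Properties
  using (_∈?_; ∉⊥; ⊥⊆; ⊆-refl; p⊆p∪q; x∈p∪q⁺; x∈p∪q⁻; p⊆q⇒∣p∣≤∣q∣; x∈p∧x≢y⇒x∈p-y; x∈p⇒∣p-x∣<∣p∣;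
         ∪-assoc; ∪-identityˡ; ∪-idempotentCommutativeMonoid)
open import Data.Vec using ([]; _∷_; here; there; lookup; tabulate)
open import Data.Vec.Properties
  using (lookup∘tabulate; lookup-zipWith; lookup-replicate; lookup⇒[]=; []=⇒lookup)
open import Data.Vec.Relation.Binary.Pointwise.Extensional using (ext; Pointwise-≡⇒≡)
open import Data.List using (List; []; _∷_; _++_; [_])
open import Data.List.Properties using (++-assoc; ++-identityʳ)
open import Data.List.Membership.Propositional using () renaming (_∈_ to _∈ˡ_)
open import Data.List.Membership.Propositional.Properties using (∈-++⁺ʳ)
open import Data.List.Relation.Unary.All using (All; []; _∷_)
open import Data.List.Relation.Unary.Any using (here; there)
open import Data.Unit using (tt)
open import Data.Product as Product using (Σ; ∃; _×_; _,_; proj₁; proj₂)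
open import Data.Sum as Sum using (_⊎_; inj₁; inj₂)
open import Data.Empty using (⊥-elim) renaming (⊥ to Empty)
open import Function using (_∘_)
open import Function.Definitions using (Injective)
open import Relation.Nullary using (yes; no)
open import Relation.Binary.PropositionalEquality
  using (_≡_; _≢_; refl; sym; trans; cong; cong₂; subst; module ≡-Reasoning)

module ∪-Solver {n : ℕ} = ICMSolver (∪-idempotentCommutativeMonoid n)
module +-Solver = CMSolver +-0-commutativeMonoid
module ⊔-Solver = CMSolver ⊔-0-commutativeMonoid

preimage : ∀ {m n} → (Fin m → Fin n) → Subset n → Subset m
preimage f X = tabulate (lookup X ∘ f)

module _ {m n} {f : Fin m → Fin n} where

  ∈-preimage⁺ : ∀ {X x} → f x ∈ X → x ∈ preimage f X
  ∈-preimage⁺ {X} {x} fx∈X =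
    lookup⇒[]= x (preimage f X) (trans (lookup∘tabulate (lookup X ∘ f) x) ([]=⇒lookup fx∈X))

  ∈-preimage⁻ : ∀ {X x} → x ∈ preimage f X → f x ∈ X
  ∈-preimage⁻ {X} {x} x∈ =
    lookup⇒[]= (f x) X (trans (sym (lookup∘tabulate (lookup X ∘ f) x)) ([]=⇒lookup x∈))

module _ {m n} (f : Fin m → Fin n) where

  preimage-∪ : ∀ X Y → preimage f (X ∪ Y) ≡ preimage f X ∪ preimage f Y
  preimage-∪ X Y = Pointwise-≡⇒≡ (ext λ x → begin
    lookup (preimage f (X ∪ Y)) x
      ≡⟨ lookup∘tabulate _ x ⟩
    lookup (X ∪ Y) (f x)
      ≡⟨ lookup-zipWith _∨_ (f x) X Y ⟩
    lookup X (f x) ∨ lookup Y (f x)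
      ≡⟨ sym (cong₂ _∨_ (lookup∘tabulate _ x) (lookup∘tabulate _ x)) ⟩
    lookup (preimage f X) x ∨ lookup (preimage f Y) x
      ≡⟨ sym (lookup-zipWith _∨_ x (preimage f X) (preimage f Y)) ⟩
    lookup (preimage f X ∪ preimage f Y) x ∎)
    where open ≡-Reasoning

  preimage-⊥ : preimage f ⊥ ≡ ⊥
  preimage-⊥ = Pointwise-≡⇒≡ (ext λ x →
    trans (lookup∘tabulate _ x) (trans (lookup-replicate (f x) outside) (sym (lookup-replicate x outside))))

∪-mono : ∀ {n} {p p′ q q′ : Subset n} → p ⊆ p′ → q ⊆ q′ → p ∪ q ⊆ p′ ∪ q′
∪-mono {p = p} {q = q} p⊆p′ q⊆q′ x∈ = x∈p∪q⁺ (Sum.map p⊆p′ q⊆q′ (x∈p∪q⁻ p q x∈))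

injection⇒∣p∣≤∣q∣ : ∀ {m n} (k : Fin m → Fin n) → Injective _≡_ _≡_ k →
                    ∀ {p q} → (∀ {x} → x ∈ p → k x ∈ q) → ∣ p ∣ ≤ ∣ q ∣
injection⇒∣p∣≤∣q∣ k k-inj {[]} k∈ = z≤n
injection⇒∣p∣≤∣q∣ k k-inj {outside ∷ p} k∈ =
  injection⇒∣p∣≤∣q∣ (k ∘ suc) (suc-injective ∘ k-inj) (λ x∈p → k∈ (there x∈p))
injection⇒∣p∣≤∣q∣ k k-inj {inside ∷ p} {q} k∈ = ≤-<-trans ∣p∣≤∣q-k0∣ (x∈p⇒∣p-x∣<∣p∣ (k∈ here))
  where
    ∣p∣≤∣q-k0∣ : ∣ p ∣ ≤ ∣ q - k zero ∣
    ∣p∣≤∣q-k0∣ = injection⇒∣p∣≤∣q∣ (k ∘ suc) (suc-injective ∘ k-inj)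
      (λ x∈p → x∈p∧x≢y⇒x∈p-y (k∈ (there x∈p)) (0≢1+n ∘ sym ∘ k-inj))

-- Walks avoiding a vertex set

data Walk (D : Digraph) (X : Subset (size D)) : Fin (size D) → Fin (size D) → Set where
  stop : ∀ {x} → x ∉ X → Walk D X x x
  move : ∀ {x y z} → x ∉ X → Edge D x y → Walk D X y z → Walk D X x z

module _ {D : Digraph} {X : Subset (size D)} where

  infixr 5 _++ʷ_
  _++ʷ_ : ∀ {x y z} → Walk D X x y → Walk D X y z → Walk D X x z
  stop _ ++ʷ Q = Q
  move x∉ e P ++ʷ Q = move x∉ e (P ++ʷ Q)

  start∉ : ∀ {x z} → Walk D X x z → x ∉ X
  start∉ (stop x∉) = x∉
  start∉ (move x∉ _ _) = x∉

  trace : ∀ {x z} → Walk D X x z → List (Fin (size D))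
  trace (stop _) = []
  trace (move {x} _ _ P) = x ∷ trace P

  trace-++ʷ : ∀ {x y z} (P : Walk D X x y) (Q : Walk D X y z) → trace (P ++ʷ Q) ≡ trace P ++ trace Q
  trace-++ʷ (stop _) Q = refl
  trace-++ʷ (move {x} _ _ P) Q = cong (x ∷_) (trace-++ʷ P Q)

  start∈trace : ∀ {x z} (P : Walk D X x z) → x ≢ z → x ∈ˡ trace P
  start∈trace (stop _) x≢x = ⊥-elim (x≢x refl)
  start∈trace (move _ _ _) _ = here refl

  trace-isWalk : ∀ {x z} (P : Walk D X x z) ys → IsWalk D (z ∷ ys) → IsWalk D (trace P ++ z ∷ ys)
  trace-isWalk (stop _) ys w = w
  trace-isWalk (move _ e (stop _)) ys w = e , w
  trace-isWalk (move _ e P@(move _ _ _)) ys w = e , trace-isWalk P ys w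

  trace-avoids : ∀ {x z} (P : Walk D X x z) → All (_∉ X) (trace P)
  trace-avoids (stop _) = []
  trace-avoids (move x∉ _ P) = x∉ ∷ trace-avoids P

  walks⇒closedWalk : ∀ {p q} → Walk D X p q → Walk D X q p → p ≢ q →
                     ∃ λ xs → IsClosedWalkIn-Minus D X p xs × q ∈ˡ p ∷ xs
  walks⇒closedWalk (stop _) _ p≢q = ⊥-elim (p≢q refl)
  walks⇒closedWalk W@(move _ _ P) Q p≢q =
    trace (P ++ʷ Q) ,
    (trace-isWalk (W ++ʷ Q) [] tt , trace-avoids (W ++ʷ Q)) ,
    there (subst (_ ∈ˡ_) (sym (trace-++ʷ P Q)) (∈-++⁺ʳ (trace P) (start∈trace Q (p≢q ∘ sym))))

  walk-to-end : ∀ {z} y ys → IsWalk D ((y ∷ ys) ++ [ z ]) → All (_∉ X) (y ∷ ys) → z ∉ X →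
                ∀ {p} → p ∈ˡ y ∷ ys → Walk D X p z
  walk-to-end y [] (e , _) (y∉ ∷ _) z∉ (here refl) = move y∉ e (stop z∉)
  walk-to-end y (y′ ∷ ys) (e , w) (y∉ ∷ ∉s) z∉ (here refl) =
    move y∉ e (walk-to-end y′ ys w ∉s z∉ (here refl))
  walk-to-end y (y′ ∷ ys) (_ , w) (_ ∷ ∉s) z∉ (there p∈) = walk-to-end y′ ys w ∉s z∉ p∈

  walk-from-start : ∀ {z} y ys → IsWalk D ((y ∷ ys) ++ [ z ]) → All (_∉ X) (y ∷ ys) →
                    ∀ {p} → p ∈ˡ y ∷ ys → Walk D X y p
  walk-from-start y ys _ (y∉ ∷ _) (here refl) = stop y∉
  walk-from-start y (y′ ∷ ys) (e , w) (y∉ ∷ ∉s) (there p∈) = move y∉ e (walk-from-start y′ ys w ∉s p∈)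

  closedWalk⇒walk : ∀ {x xs} → IsClosedWalkIn-Minus D X x xs →
                    ∀ {p q} → p ∈ˡ x ∷ xs → q ∈ˡ x ∷ xs → Walk D X p q
  closedWalk⇒walk {x} {xs} (w , ∉s@(x∉ ∷ _)) p∈ q∈ =
    walk-to-end x xs w ∉s x∉ p∈ ++ʷ walk-from-start x xs w ∉s q∈

NoCrossingWalks : (D : Digraph) → Subset (size D) → Subset (size D) → Set
NoCrossingWalks D X S = ∀ {p q} → p ∈ S → q ∉ S → Walk D X p q → Walk D X q p → Empty

module _ {D : Digraph} {X S : Subset (size D)} where

  noCrossingClosedWalk⇒noCrossingWalks : NoCrossingClosedWalk D X S → NoCrossingWalks D X S
  noCrossingClosedWalk⇒noCrossingWalks nc p∈S q∉S P Q with walks⇒closedWalk P Q (λ { refl → q∉S p∈S })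
  ... | xs , cw , q∈ = nc _ xs cw _ _ (here refl) q∈ p∈S q∉S

  noCrossingWalks⇒noCrossingClosedWalk : NoCrossingWalks D X S → NoCrossingClosedWalk D X S
  noCrossingWalks⇒noCrossingClosedWalk nc x xs cw p q p∈ q∈ p∈S q∉S =
    nc p∈S q∉S (closedWalk⇒walk cw p∈ q∈) (closedWalk⇒walk cw q∈ p∈)

-- Pulling decompositions back along a model

Children : ℕ → Set
Children n = List (Subset n × DTree n)

IsWeakNCWDecomposition : (D : Digraph) → DTree (size D) → Set
IsWeakNCWDecomposition D T = (∀ v → occ v T ≡ 1) × EdgesOK D T

infix 4 _≼_
_≼_ : Digraph → Digraph → Set
D′ ≼ D = ∀ T → IsWeakNCWDecomposition D T →
         Σ (DTree (size D′)) λ T′ → IsWeakNCWDecomposition D′ T′ × width T′ ≤ width T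

≼-refl : ∀ {D} → D ≼ D
≼-refl T dec = T , dec , ≤-refl

≼-trans : ∀ {D₂ D₁ D} → D₂ ≼ D₁ → D₁ ≼ D → D₂ ≼ D
≼-trans D₂≼D₁ D₁≼D T dec with D₁≼D T dec
... | T₁ , dec₁ , T₁≤T with D₂≼D₁ T₁ dec₁
...   | T₂ , dec₂ , T₂≤T₁ = T₂ , dec₂ , ≤-trans T₂≤T₁ T₁≤T

record Model (D′ D : Digraph) : Set where
  field
    rep₁ rep₂      : Fin (size D′) → Fin (size D)
    rep₁-injective : Injective _≡_ _≡_ rep₁
    rep₂-injective : Injective _≡_ _≡_ rep₂
    rep₁≡rep₂⇒≡    : ∀ {a c} → rep₁ a ≡ rep₂ c → a ≡ c
    lift-edge      : ∀ {X a c} → Edge D′ a c →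
                     rep₁ a ∉ X → rep₂ a ∉ X → rep₁ c ∉ X → rep₂ c ∉ X →
                     Walk D X (rep₁ a) (rep₁ c)

module Pullback {D′ D : Digraph} (M : Model D′ D) where
  open Model M

  touching : Subset (size D) → Subset (size D′)
  touching X = preimage rep₁ X ∪ preimage rep₂ X

  touching-∪ : ∀ X Y → touching (X ∪ Y) ≡ touching X ∪ touching Y
  touching-∪ X Y = begin
    preimage rep₁ (X ∪ Y) ∪ preimage rep₂ (X ∪ Y)
      ≡⟨ cong₂ _∪_ (preimage-∪ rep₁ X Y) (preimage-∪ rep₂ X Y) ⟩
    (preimage rep₁ X ∪ preimage rep₁ Y) ∪ (preimage rep₂ X ∪ preimage rep₂ Y)
      ≡⟨ solve 4 (λ x₁ y₁ x₂ y₂ → (x₁ ⊕ y₁) ⊕ (x₂ ⊕ y₂) ⊜ (x₁ ⊕ x₂) ⊕ (y₁ ⊕ y₂)) refl _ _ _ _ ⟩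
    touching X ∪ touching Y ∎
    where
      open ≡-Reasoning
      open ∪-Solver

  touching-⊥ : touching ⊥ ≡ ⊥
  touching-⊥ = trans (cong₂ _∪_ (preimage-⊥ rep₁) (preimage-⊥ rep₂)) (∪-identityˡ ⊥)

  ∉touching⇒rep₁∉ : ∀ {X a} → a ∉ touching X → rep₁ a ∉ X
  ∉touching⇒rep₁∉ a∉ rep₁a∈ = a∉ (x∈p∪q⁺ (inj₁ (∈-preimage⁺ rep₁a∈)))

  ∉touching⇒rep₂∉ : ∀ {X a} → a ∉ touching X → rep₂ a ∉ X
  ∉touching⇒rep₂∉ a∉ rep₂a∈ = a∉ (x∈p∪q⁺ (inj₂ (∈-preimage⁺ rep₂a∈)))

  ∣touching∣≤ : ∀ X → ∣ touching X ∣ ≤ ∣ X ∣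
  ∣touching∣≤ X = injection⇒∣p∣≤∣q∣ pick pick-injective pick-∈
    where
      pick : Fin (size D′) → Fin (size D)
      pick a with rep₁ a ∈? X
      ... | yes _ = rep₁ a
      ... | no _ = rep₂ a

      pick-injective : Injective _≡_ _≡_ pick
      pick-injective {a} {c} with rep₁ a ∈? X | rep₁ c ∈? X
      ... | yes _ | yes _ = rep₁-injective
      ... | yes _ | no _ = rep₁≡rep₂⇒≡
      ... | no _ | yes _ = sym ∘ rep₁≡rep₂⇒≡ ∘ sym
      ... | no _ | no _ = rep₂-injective

      pick-∈ : ∀ {a} → a ∈ touching X → pick a ∈ X
      pick-∈ {a} a∈ with rep₁ a ∈? X
      ... | yes rep₁a∈ = rep₁a∈
      ... | no rep₁a∉ with x∈p∪q⁻ (preimage rep₁ X) (preimage rep₂ X) a∈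
      ...   | inj₁ a∈₁ = ⊥-elim (rep₁a∉ (∈-preimage⁻ a∈₁))
      ...   | inj₂ a∈₂ = ∈-preimage⁻ a∈₂

  lift-walk : ∀ {X a c} → Walk D′ (touching X) a c → Walk D X (rep₁ a) (rep₁ c)
  lift-walk (stop a∉) = stop (∉touching⇒rep₁∉ a∉)
  lift-walk (move a∉ e P) =
    lift-edge e (∉touching⇒rep₁∉ a∉) (∉touching⇒rep₂∉ a∉)
                (∉touching⇒rep₁∉ (start∉ P)) (∉touching⇒rep₂∉ (start∉ P))
    ++ʷ lift-walk P

  noCrossing-pullback : ∀ {X S} → NoCrossingClosedWalk D X S →
                        NoCrossingClosedWalk D′ (touching X) (preimage rep₁ S)
  noCrossing-pullback nc = noCrossingWalks⇒noCrossingClosedWalk λ p∈ q∉ P Q →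
    noCrossingClosedWalk⇒noCrossingWalks nc (∈-preimage⁻ p∈) (q∉ ∘ ∈-preimage⁺) (lift-walk P) (lift-walk Q)

  mutual
    pullback : DTree (size D) → DTree (size D′)
    pullback (node b cs) = node (preimage rep₁ b) (pullbacks cs)

    pullbacks : Children (size D) → Children (size D′)
    pullbacks [] = []
    pullbacks ((g , t) ∷ cs) = (touching g , pullback t) ∷ pullbacks cs

  mutual
    occ-pullback : ∀ a t → occ a (pullback t) ≡ occ (rep₁ a) t
    occ-pullback a (node b cs) =
      cong₂ _+_ (cong (λ s → if s then 1 else 0) (lookup∘tabulate (lookup b ∘ rep₁) a)) (occs-pullback a cs)

    occs-pullback : ∀ a cs → occs a (pullbacks cs) ≡ occs (rep₁ a) cs
    occs-pullback a [] = refl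
    occs-pullback a ((g , t) ∷ cs) = cong₂ _+_ (occ-pullback a t) (occs-pullback a cs)

  mutual
    βsub-pullback : ∀ t → βsub (pullback t) ≡ preimage rep₁ (βsub t)
    βsub-pullback (node b cs) =
      trans (cong (preimage rep₁ b ∪_) (βsubs-pullback cs)) (sym (preimage-∪ rep₁ b (βsubs cs)))

    βsubs-pullback : ∀ cs → βsubs (pullbacks cs) ≡ preimage rep₁ (βsubs cs)
    βsubs-pullback [] = sym (preimage-⊥ rep₁)
    βsubs-pullback ((g , t) ∷ cs) =
      trans (cong₂ _∪_ (βsub-pullback t) (βsubs-pullback cs)) (sym (preimage-∪ rep₁ (βsub t) (βsubs cs)))

  γchildren-pullbacks : ∀ cs → γchildren (pullbacks cs) ≡ touching (γchildren cs)
  γchildren-pullbacks [] = sym touching-⊥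
  γchildren-pullbacks ((g , t) ∷ cs) =
    trans (cong (touching g ∪_) (γchildren-pullbacks cs)) (sym (touching-∪ g (γchildren cs)))

  mutual
    EdgesOK-pullback : ∀ t → EdgesOK D t → EdgesOK D′ (pullback t)
    EdgesOK-pullback (node b cs) = EdgesOKs-pullbacks cs

    EdgesOKs-pullbacks : ∀ cs → EdgesOKs D cs → EdgesOKs D′ (pullbacks cs)
    EdgesOKs-pullbacks [] tt = tt
    EdgesOKs-pullbacks ((g , t) ∷ cs) (nc , ok , oks) =
      subst (NoCrossingClosedWalk D′ (touching g)) (sym (βsub-pullback t)) (noCrossing-pullback nc) ,
      EdgesOK-pullback t ok , EdgesOKs-pullbacks cs oks

  Γ-pullback-⊆ : ∀ {g′ g} b cs → g′ ⊆ touching g →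
                 preimage rep₁ b ∪ (g′ ∪ γchildren (pullbacks cs)) ⊆ touching (b ∪ (g ∪ γchildren cs))
  Γ-pullback-⊆ {g′} {g} b cs g′⊆ rewrite γchildren-pullbacks cs | touching-∪ b (g ∪ γchildren cs)
                                        | touching-∪ g (γchildren cs) =
    ∪-mono (p⊆p∪q (preimage rep₂ b)) (∪-mono g′⊆ ⊆-refl)

  mutual
    widthFrom-pullback : ∀ {g′ g} → g′ ⊆ touching g → ∀ t → widthFrom g′ (pullback t) ≤ widthFrom g t
    widthFrom-pullback {g′} {g} g′⊆ (node b cs) = ⊔-mono-≤
      (∸-monoˡ-≤ 1 (≤-trans (p⊆q⇒∣p∣≤∣q∣ (Γ-pullback-⊆ {g′} {g} b cs g′⊆))
                            (∣touching∣≤ (b ∪ (g ∪ γchildren cs)))))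
      (widthsFrom-pullbacks cs)

    widthsFrom-pullbacks : ∀ cs → widthsFrom (pullbacks cs) ≤ widthsFrom cs
    widthsFrom-pullbacks [] = z≤n
    widthsFrom-pullbacks ((g , t) ∷ cs) = ⊔-mono-≤ (widthFrom-pullback ⊆-refl t) (widthsFrom-pullbacks cs)

model⇒≼ : ∀ {D′ D} → Model D′ D → D′ ≼ D
model⇒≼ M T (partition , ok) =
  pullback T , ((λ a → trans (occ-pullback a T) (partition (rep₁ a))) , EdgesOK-pullback T ok) ,
  widthFrom-pullback ⊥⊆ T
  where
    open Model M
    open Pullback M

-- Subgraphs and butterfly contractions

subgraph-model : ∀ {S D} → SubgraphOf S D → Model S D
subgraph-model (f , f-injective , f-edge) = record
  { rep₁           = f
  ; rep₂           = f
  ; rep₁-injective = f-injective _ _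
  ; rep₂-injective = f-injective _ _
  ; rep₁≡rep₂⇒≡    = f-injective _ _
  ; lift-edge      = λ e a∉ _ c∉ _ → move a∉ (f-edge _ _ e) (stop c∉)
  }

ContractionOf-sym : ∀ {D′ D u v} → ContractionOf D′ D u v → ContractionOf D′ D v u
ContractionOf-sym (φ , surjective , φu≡φv , fibres , edges) =
  φ , surjective , sym φu≡φv , (λ x y → Sum.map₂ (Product.map Sum.swap Sum.swap) ∘ fibres x y) , edges

module Contraction {D′ D : Digraph} {k d : Fin (size D)} (co : ContractionOf D′ D k d) where

  φ : Fin (size D) → Fin (size D′)
  φ = proj₁ co

  section : Fin (size D′) → Fin (size D)
  section a = proj₁ (proj₁ (proj₂ co) a)

  φ∘section : ∀ a → φ (section a) ≡ a
  φ∘section a = proj₂ (proj₁ (proj₂ co) a)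

  φk≡φd : φ k ≡ φ d
  φk≡φd = proj₁ (proj₂ (proj₂ co))

  φ-fibre : ∀ x y → φ x ≡ φ y → x ≡ y ⊎ ((x ≡ k ⊎ x ≡ d) × (y ≡ k ⊎ y ≡ d))
  φ-fibre = proj₁ (proj₂ (proj₂ (proj₂ co)))

  edge-preimage : ∀ {a c} → Edge D′ a c →
                  a ≢ c × Σ (Fin (size D)) λ x → Σ (Fin (size D)) λ y → φ x ≡ a × φ y ≡ c × Edge D x y
  edge-preimage {a} {c} = proj₁ (proj₂ (proj₂ (proj₂ (proj₂ co))) a c)

  merged : Fin (size D′)
  merged = φ k

  φ-merged : ∀ {z} → z ≡ k ⊎ z ≡ d → φ z ≡ merged
  φ-merged (inj₁ refl) = refl
  φ-merged (inj₂ refl) = sym φk≡φd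

  rep₁ rep₂ : Fin (size D′) → Fin (size D)
  rep₁ a with a ≟ merged
  ... | yes _ = k
  ... | no _ = section a
  rep₂ a with a ≟ merged
  ... | yes _ = d
  ... | no _ = section a

  φ∘rep₁ : ∀ a → φ (rep₁ a) ≡ a
  φ∘rep₁ a with a ≟ merged
  ... | yes a≡m = sym a≡m
  ... | no _ = φ∘section a

  φ∘rep₂ : ∀ a → φ (rep₂ a) ≡ a
  φ∘rep₂ a with a ≟ merged
  ... | yes a≡m = trans (φ-merged (inj₂ refl)) (sym a≡m)
  ... | no _ = φ∘section a

  rep₁-merged : rep₁ merged ≡ k
  rep₁-merged with merged ≟ merged
  ... | yes _ = refl
  ... | no m≢m = ⊥-elim (m≢m refl)

  rep₂-merged : rep₂ merged ≡ d
  rep₂-merged with merged ≟ merged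
  ... | yes _ = refl
  ... | no m≢m = ⊥-elim (m≢m refl)

  rep₁∘φ : ∀ {z} → z ≢ d → rep₁ (φ z) ≡ z
  rep₁∘φ {z} z≢d with φ-fibre (rep₁ (φ z)) z (φ∘rep₁ (φ z))
  ... | inj₁ eq = eq
  ... | inj₂ (_ , inj₁ refl) = rep₁-merged
  ... | inj₂ (_ , inj₂ z≡d) = ⊥-elim (z≢d z≡d)

  rep₁∘φ-d : rep₁ (φ d) ≡ k
  rep₁∘φ-d = trans (cong rep₁ (sym φk≡φd)) rep₁-merged

  rep₂∘φ-d : rep₂ (φ d) ≡ d
  rep₂∘φ-d = trans (cong rep₂ (sym φk≡φd)) rep₂-merged

  LiftsEdges : Set
  LiftsEdges = ∀ {X x y} → Edge D x y → φ x ≢ φ y →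
               rep₁ (φ x) ∉ X → rep₂ (φ x) ∉ X → rep₁ (φ y) ∉ X → rep₂ (φ y) ∉ X →
               Walk D X (rep₁ (φ x)) (rep₁ (φ y))

  model : LiftsEdges → Model D′ D
  model lifts = record
    { rep₁           = rep₁
    ; rep₂           = rep₂
    ; rep₁-injective = λ {a} {c} eq → trans (sym (φ∘rep₁ a)) (trans (cong φ eq) (φ∘rep₁ c))
    ; rep₂-injective = λ {a} {c} eq → trans (sym (φ∘rep₂ a)) (trans (cong φ eq) (φ∘rep₂ c))
    ; rep₁≡rep₂⇒≡    = λ {a} {c} eq → trans (sym (φ∘rep₁ a)) (trans (cong φ eq) (φ∘rep₂ c))
    ; lift-edge      = lift-edge
    }
    where
      lift-edge : ∀ {X a c} → Edge D′ a c → rep₁ a ∉ X → rep₂ a ∉ X → rep₁ c ∉ X → rep₂ c ∉ X →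
                  Walk D X (rep₁ a) (rep₁ c)
      lift-edge e with edge-preimage e
      ... | a≢c , x , y , refl , refl , exy = lifts exy a≢c

  lift-single-edge : ∀ {X x y} → Edge D x y → x ≢ d → y ≢ d → rep₁ (φ x) ∉ X → rep₁ (φ y) ∉ X →
                     Walk D X (rep₁ (φ x)) (rep₁ (φ y))
  lift-single-edge e x≢d y≢d x∉ y∉ rewrite rep₁∘φ x≢d | rep₁∘φ y≢d = move x∉ e (stop y∉)

  lift-edge-via-dk : Edge D d k → ∀ {X x y} → Edge D x y → x ≢ d →
                     rep₁ (φ x) ∉ X → rep₁ (φ y) ∉ X → rep₂ (φ y) ∉ X → Walk D X (rep₁ (φ x)) (rep₁ (φ y))
  lift-edge-via-dk dk {X} {x} {y} e x≢d x∉ y∉ y∉₂ with y ≟ d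
  ... | no y≢d = lift-single-edge e x≢d y≢d x∉ y∉
  ... | yes refl rewrite rep₁∘φ x≢d | rep₁∘φ-d | rep₂∘φ-d = move x∉ e (move y∉₂ dk (stop y∉))

  lift-edge-via-kd : Edge D k d → ∀ {X x y} → Edge D x y → y ≢ d →
                     rep₁ (φ x) ∉ X → rep₂ (φ x) ∉ X → rep₁ (φ y) ∉ X → Walk D X (rep₁ (φ x)) (rep₁ (φ y))
  lift-edge-via-kd kd {X} {x} {y} e y≢d x∉ x∉₂ y∉ with x ≟ d
  ... | no x≢d = lift-single-edge e x≢d y≢d x∉ y∉
  ... | yes refl rewrite rep₁∘φ y≢d | rep₁∘φ-d | rep₂∘φ-d = move x∉ kd (move x∉₂ e (stop y∉))

  -- An edge of D leaving d can only be the contracted one, which φ collapses.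
  liftsEdges-outUnique : Edge D d k → (∀ w → Edge D d w → w ≡ k) → LiftsEdges
  liftsEdges-outUnique dk unique e φx≢φy x∉ _ y∉ y∉₂ = lift-edge-via-dk dk e x≢d x∉ y∉ y∉₂
    where x≢d = λ { refl → φx≢φy (trans (sym φk≡φd) (cong φ (sym (unique _ e)))) }

  liftsEdges-inUnique : Edge D k d → (∀ w → Edge D w d → w ≡ k) → LiftsEdges
  liftsEdges-inUnique kd unique e φx≢φy x∉ x∉₂ y∉ _ = lift-edge-via-kd kd e y≢d x∉ x∉₂ y∉
    where y≢d = λ { refl → φx≢φy (trans (cong φ (unique _ e)) φk≡φd) }

contraction-model : ∀ {D′ D u v} → ButterflyContractible D u v → ContractionOf D′ D u v → Model D′ D
contraction-model {D′} {D} {u} {v} (uv , inj₁ out-unique) co = model (liftsEdges-outUnique uv out-unique)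
  where open Contraction {k = v} {u} (ContractionOf-sym {D′} {D} {u} {v} co)
contraction-model {u = u} {v} (uv , inj₂ in-unique) co = model (liftsEdges-inUnique uv in-unique)
  where open Contraction {k = u} {v} co

contracts⇒≼ : ∀ {D D′} → Contracts D D′ → D′ ≼ D
contracts⇒≼ done = ≼-refl
contracts⇒≼ (step u v contractible co rest) =
  ≼-trans (contracts⇒≼ rest) (model⇒≼ (contraction-model contractible co))

butterflyMinor⇒≼ : ∀ {D′ D} → ButterflyMinor D′ D → D′ ≼ D
butterflyMinor⇒≼ (S , subgraph , contractions) =
  ≼-trans (contracts⇒≼ contractions) (model⇒≼ (subgraph-model subgraph))

-- Rerooting

0<m+n⇒0<m⊎0<n : ∀ m {n} → 0 < m + n → 0 < m ⊎ 0 < n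
0<m+n⇒0<m⊎0<n zero 0<n = inj₂ 0<n
0<m+n⇒0<m⊎0<n (suc m) _ = inj₁ (s≤s z≤n)

module _ {n : ℕ} where

  mutual
    ∈βsub⇒occ>0 : ∀ {x} (t : DTree n) → x ∈ βsub t → 0 < occ x t
    ∈βsub⇒occ>0 (node b cs) x∈ with x∈p∪q⁻ b (βsubs cs) x∈
    ... | inj₁ x∈b rewrite []=⇒lookup x∈b = s≤s z≤n
    ... | inj₂ x∈cs = ≤-trans (∈βsubs⇒occs>0 cs x∈cs) (m≤n+m _ _)

    ∈βsubs⇒occs>0 : ∀ {x} (cs : Children n) → x ∈ βsubs cs → 0 < occs x cs
    ∈βsubs⇒occs>0 [] x∈ = ⊥-elim (∉⊥ x∈)
    ∈βsubs⇒occs>0 ((g , t) ∷ cs) x∈ with x∈p∪q⁻ (βsub t) (βsubs cs) x∈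
    ... | inj₁ x∈t = ≤-trans (∈βsub⇒occ>0 t x∈t) (m≤m+n _ _)
    ... | inj₂ x∈cs = ≤-trans (∈βsubs⇒occs>0 cs x∈cs) (m≤n+m _ _)

  mutual
    occ>0⇒∈βsub : ∀ {x} (t : DTree n) → 0 < occ x t → x ∈ βsub t
    occ>0⇒∈βsub {x} (node b cs) pos with lookup b x in eq
    ... | true = x∈p∪q⁺ (inj₁ (lookup⇒[]= x b eq))
    ... | false = x∈p∪q⁺ (inj₂ (occs>0⇒∈βsubs cs pos))

    occs>0⇒∈βsubs : ∀ {x} (cs : Children n) → 0 < occs x cs → x ∈ βsubs cs
    occs>0⇒∈βsubs {x} ((g , t) ∷ cs) pos with 0<m+n⇒0<m⊎0<n (occ x t) pos
    ... | inj₁ pos-t = x∈p∪q⁺ (inj₁ (occ>0⇒∈βsub t pos-t))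
    ... | inj₂ pos-cs = x∈p∪q⁺ (inj₂ (occs>0⇒∈βsubs cs pos-cs))

  ∉βsub⇒occ≡0 : ∀ {x} (t : DTree n) → x ∉ βsub t → occ x t ≡ 0
  ∉βsub⇒occ≡0 t x∉ = n≤0⇒n≡0 (≮⇒≥ (x∉ ∘ occ>0⇒∈βsub t))

  module _ {x : Fin n} (t u : DTree n) (once : occ x t + occ x u ≡ 1) where

    ∈βsub⇒∉βsub : x ∈ βsub t → x ∉ βsub u
    ∈βsub⇒∉βsub x∈t x∈u with subst (2 ≤_) once (+-mono-≤ (∈βsub⇒occ>0 t x∈t) (∈βsub⇒occ>0 u x∈u))
    ... | s≤s ()

    ∉βsub⇒∈βsub : x ∉ βsub t → x ∈ βsub u
    ∉βsub⇒∈βsub x∉t = occ>0⇒∈βsub u (subst (0 <_) (sym occ-u≡1) (s≤s z≤n))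
      where
        occ-u≡1 : occ x u ≡ 1
        occ-u≡1 = trans (cong (_+ occ x u) (sym (∉βsub⇒occ≡0 t x∉t))) once

  occs-++ : ∀ x (xs ys : Children n) → occs x (xs ++ ys) ≡ occs x xs + occs x ys
  occs-++ x [] ys = refl
  occs-++ x ((g , t) ∷ xs) ys = trans (cong (occ x t +_) (occs-++ x xs ys)) (sym (+-assoc (occ x t) _ _))

  widthsFrom-++ : ∀ (xs ys : Children n) → widthsFrom (xs ++ ys) ≡ widthsFrom xs ⊔ widthsFrom ys
  widthsFrom-++ [] ys = refl
  widthsFrom-++ ((g , t) ∷ xs) ys =
    trans (cong (widthFrom g t ⊔_) (widthsFrom-++ xs ys)) (sym (⊔-assoc (widthFrom g t) _ _))

  γchildren-++ : ∀ (xs ys : Children n) → γchildren (xs ++ ys) ≡ γchildren xs ∪ γchildren ys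
  γchildren-++ [] ys = sym (∪-identityˡ _)
  γchildren-++ ((g , t) ∷ xs) ys = trans (cong (g ∪_) (γchildren-++ xs ys)) (sym (∪-assoc g _ _))

  rotate : Subset n → Children n → Subset n → DTree n → Children n → DTree n
  rotate b pre g (node b₁ cs₁) post = node b₁ (cs₁ ++ [ (g , node b (pre ++ post)) ])

  module _ (b : Subset n) (pre : Children n) (g b₁ : Subset n)
           (cs₁ post : Children n) where

    occ-detach : ∀ x → occ x (node b (pre ++ (g , node b₁ cs₁) ∷ post)) ≡
                          occ x (node b (pre ++ post)) + occ x (node b₁ cs₁)
    occ-detach x rewrite occs-++ x pre ((g , node b₁ cs₁) ∷ post) | occs-++ x pre post =
      shuffle (if lookup b x then 1 else 0) (occs x pre) (occ x (node b₁ cs₁)) (occs x post)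
      where
        shuffle : ∀ r p o q → r + (p + (o + q)) ≡ (r + (p + q)) + o
        shuffle = solve 4 (λ r p o q → r ⊕ (p ⊕ (o ⊕ q)) ⊜ (r ⊕ (p ⊕ q)) ⊕ o) refl
          where open +-Solver

    occ-rotate : ∀ x → occ x (rotate b pre g (node b₁ cs₁) post) ≡
                       occ x (node b (pre ++ post)) + occ x (node b₁ cs₁)
    occ-rotate x rewrite occs-++ x cs₁ [ (g , node b (pre ++ post)) ] =
      shuffle (if lookup b₁ x then 1 else 0) (occs x cs₁) (occ x (node b (pre ++ post)))
      where
        shuffle : ∀ r₁ c₁ u → r₁ + (c₁ + (u + 0)) ≡ u + (r₁ + c₁)
        shuffle = solve 3 (λ r₁ c₁ u → r₁ ⊕ (c₁ ⊕ (u ⊕ id)) ⊜ u ⊕ (r₁ ⊕ c₁)) refl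
          where open +-Solver

    Γ-new-root : b₁ ∪ (⊥ ∪ γchildren (cs₁ ++ [ (g , node b (pre ++ post)) ])) ≡ b₁ ∪ (g ∪ γchildren cs₁)
    Γ-new-root rewrite γchildren-++ cs₁ [ (g , node b (pre ++ post)) ] =
      solve 3 (λ r₁ c₁ h → r₁ ⊕ (id ⊕ (c₁ ⊕ (h ⊕ id))) ⊜ r₁ ⊕ (h ⊕ c₁)) refl _ _ _
      where open ∪-Solver

    Γ-old-root : b ∪ (g ∪ γchildren (pre ++ post)) ≡ b ∪ (⊥ ∪ γchildren (pre ++ (g , node b₁ cs₁) ∷ post))
    Γ-old-root rewrite γchildren-++ pre post | γchildren-++ pre ((g , node b₁ cs₁) ∷ post) =
      solve 4 (λ r h p q → r ⊕ (h ⊕ (p ⊕ q)) ⊜ r ⊕ (id ⊕ (p ⊕ (h ⊕ q)))) refl _ _ _ _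
      where open ∪-Solver

    width-rotate : width (rotate b pre g (node b₁ cs₁) post) ≡
                   width (node b (pre ++ (g , node b₁ cs₁) ∷ post))
    width-rotate
      rewrite widthsFrom-++ cs₁ [ (g , node b (pre ++ post)) ]
            | widthsFrom-++ pre ((g , node b₁ cs₁) ∷ post) | widthsFrom-++ pre post
            | Γ-new-root | Γ-old-root =
      shuffle (∣ b₁ ∪ (g ∪ γchildren cs₁) ∣ ∸ 1) (widthsFrom cs₁)
              (∣ b ∪ (⊥ ∪ γchildren (pre ++ (g , node b₁ cs₁) ∷ post)) ∣ ∸ 1) (widthsFrom pre) (widthsFrom post)
      where
        shuffle : ∀ r₁ c₁ r p q → r₁ ⊔ (c₁ ⊔ ((r ⊔ (p ⊔ q)) ⊔ 0)) ≡ r ⊔ (p ⊔ ((r₁ ⊔ c₁) ⊔ q))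
        shuffle = solve 5 (λ r₁ c₁ r p q → r₁ ⊕ (c₁ ⊕ ((r ⊕ (p ⊕ q)) ⊕ id)) ⊜ r ⊕ (p ⊕ ((r₁ ⊕ c₁) ⊕ q))) refl
          where open ⊔-Solver

module _ {D : Digraph} where

  EdgesOKs-++⁺ : ∀ {xs ys} → EdgesOKs D xs → EdgesOKs D ys → EdgesOKs D (xs ++ ys)
  EdgesOKs-++⁺ {[]} _ ok-ys = ok-ys
  EdgesOKs-++⁺ {_ ∷ xs} (nc , ok , ok-xs) ok-ys = nc , ok , EdgesOKs-++⁺ ok-xs ok-ys

  EdgesOKs-++⁻ : ∀ xs {ys} → EdgesOKs D (xs ++ ys) → EdgesOKs D xs × EdgesOKs D ys
  EdgesOKs-++⁻ [] ok-ys = tt , ok-ys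
  EdgesOKs-++⁻ (_ ∷ xs) (nc , ok , ok-xsys) =
    Product.map₁ (λ ok-xs → nc , ok , ok-xs) (EdgesOKs-++⁻ xs ok-xsys)

  noCrossing-complement : ∀ {X S S′} → (∀ {x} → x ∈ S′ → x ∉ S) → (∀ {x} → x ∉ S′ → x ∈ S) →
                          NoCrossingClosedWalk D X S → NoCrossingClosedWalk D X S′
  noCrossing-complement disjoint covering nc x xs cw p q p∈ q∈ p∈S′ q∉S′ =
    nc x xs cw q p q∈ p∈ (covering q∉S′) (disjoint p∈S′)

  rotate-weak : ∀ b pre g b₁ cs₁ post →
                IsWeakNCWDecomposition D (node b (pre ++ (g , node b₁ cs₁) ∷ post)) →
                IsWeakNCWDecomposition D (rotate b pre g (node b₁ cs₁) post)
  rotate-weak b pre g b₁ cs₁ post (partition , ok) with EdgesOKs-++⁻ pre ok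
  ... | ok-pre , nc , ok₁ , ok-post =
    (λ x → trans (occ-rotate b pre g b₁ cs₁ post x) (once x)) ,
    EdgesOKs-++⁺ ok₁ (noCrossing-complement (∈βsub⇒∉βsub U t₁ (once _)) (∉βsub⇒∈βsub U t₁ (once _)) nc ,
                      EdgesOKs-++⁺ ok-pre ok-post , tt)
    where
      U t₁ : DTree (size D)
      U = node b (pre ++ post)
      t₁ = node b₁ cs₁
      once : ∀ x → occ x U + occ x t₁ ≡ 1
      once x = trans (sym (occ-detach b pre g b₁ cs₁ post x)) (partition x)

  Rerooted : DTree (size D) → Set
  Rerooted T = Σ (DTree (size D)) λ T′ → IsNCWDecomposition D T′ × width T′ ≤ width T

  module _ (v : Fin (size D)) where
    mutual
      reroot-node : ∀ b cs extra → IsWeakNCWDecomposition D (node b (cs ++ extra)) → v ∈ b ∪ βsubs cs →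
                    Rerooted (node b (cs ++ extra))
      reroot-node b cs extra (partition , ok) v∈ with v ∈? b
      ... | yes v∈b = node b (cs ++ extra) , (partition , (v , v∈b) , ok) , ≤-refl
      ... | no v∉b =
        reroot-children b [] cs extra (partition , ok) (Sum.fromInj₂ (⊥-elim ∘ v∉b) (x∈p∪q⁻ b _ v∈))

      reroot-children : ∀ b pre cs extra → IsWeakNCWDecomposition D (node b (pre ++ cs ++ extra)) →
                        v ∈ βsubs cs → Rerooted (node b (pre ++ cs ++ extra))
      reroot-children b pre [] extra _ v∈ = ⊥-elim (∉⊥ v∈)
      reroot-children b pre ((g , node b₁ cs₁) ∷ cs) extra weak v∈ with x∈p∪q⁻ (βsub (node b₁ cs₁)) _ v∈
      ... | inj₁ v∈t₁ with reroot-node b₁ cs₁ [ (g , node b (pre ++ cs ++ extra)) ]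
                             (rotate-weak b pre g b₁ cs₁ (cs ++ extra) weak) v∈t₁
      ...   | T′ , dec , T′≤ =
        T′ , dec , ≤-trans T′≤ (≤-reflexive (width-rotate b pre g b₁ cs₁ (cs ++ extra)))
      reroot-children b pre ((g , t₁) ∷ cs) extra weak v∈ | inj₂ v∈cs =
        subst Rerooted shift
          (reroot-children b (pre ++ [ (g , t₁) ]) cs extra (subst (IsWeakNCWDecomposition D) (sym shift) weak) v∈cs)
        where
          shift : node b ((pre ++ [ (g , t₁) ]) ++ cs ++ extra) ≡ node b (pre ++ (g , t₁) ∷ cs ++ extra)
          shift = cong (node b) (++-assoc pre [ (g , t₁) ] (cs ++ extra))

  reroot : ∀ {T} → IsWeakNCWDecomposition D T → Fin (size D) → Rerooted T
  reroot {node b cs} weak v =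
    subst Rerooted no-extra (reroot-node v b cs [] (subst (IsWeakNCWDecomposition D) (sym no-extra) weak) v∈)
    where
      no-extra : node b (cs ++ []) ≡ node b cs
      no-extra = cong (node b) (++-identityʳ cs)
      v∈ : v ∈ b ∪ βsubs cs
      v∈ = occ>0⇒∈βsub (node b cs) (subst (0 <_) (sym (proj₁ weak v)) (s≤s z≤n))

theorem4p10 : (D D' : Digraph) → ButterflyMinor D' D →
    (w w' : ℕ) → IsNCW D w → IsNCW D' w' → w' ≤ w
theorem4p10 D D' minor _ w' ((T , (partition , _ , ok) , refl) , _) ((_ , (_ , (v , _) , _) , _) , minimal) =
  let (T′ , weak′ , T′≤T) = butterflyMinor⇒≼ minor T (partition , ok)
      (T″ , dec″ , T″≤T′) = reroot {D'} {T′} weak′ v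
  in ≤-trans (minimal T″ dec″) (≤-trans T″≤T′ T′≤T)
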